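{- Let $w=X^{\alpha_1}Y^{\beta_1}X^{\alpha_2}Y^{\beta_2}\cdots X^{\alpha_t}Y^{\beta_t}$ be a monotone word in the free group $\mathbf{F}_2=\langle X,Y\rangle$ with every $\alpha_i,\beta_i\neq0$, and let $a=\sum_{i=1}^t\alpha_i$. Then the $(x,z)$-degree of $P_w$ is at most $|a|$.
   Context: A (reduced) word in $\mathbf{F}_2$ is monotone if for each letter $X$, $Y$, all exponents of that letter in the word have the same sign. $P_w\in\mathbf{Z}[x,y,z]$ is the unique polynomial with $\mathrm{tr}(w(A,B))=P_w(\mathrm{tr}A,\mathrm{tr}B,\mathrm{tr}AB)$ for all $A,B\in\mathrm{SL}_2(\mathbf{C})$. The $(x,z)$-degree of a monomial $x^{\alpha}y^{\beta}z^{\gamma}$ (possibly times a power of an extra variable $\kappa$) is $\alpha+\gamma$; the $(x,z)$-degree of a polynomial is the maximum over its monomials with nonzero coefficient. -}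

module Defs where

open import Level using (0ℓ)
open import Data.Nat as ℕ using (ℕ; zero; suc)
open import Data.Integer as ℤ using (ℤ; +_; -[1+_])
open import Data.Fin using (Fin; zero; suc; toℕ)
open import Algebra.Bundles using (CommutativeRing)

-- Words X^{α₁} Y^{β₁} ⋯ X^{α_t} Y^{β_t} in F₂ = ⟨X,Y⟩ are given by
-- t : ℕ together with exponent sequences α β : Fin t → ℤ.

sumℤ : ∀ {t} → (Fin t → ℤ) → ℤ
sumℤ {zero}  f = + 0
sumℤ {suc t} f = f zero ℤ.+ sumℤ (λ i → f (suc i))

AllNonzero : ∀ {t} → (Fin t → ℤ) → Set
AllNonzero {t} f = (i : Fin t) → f i ≢ + 0
  where open import Relation.Binary.PropositionalEquality using (_≢_)

SameSign : ∀ {t} → (Fin t → ℤ) → Set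
SameSign {t} f = ((i : Fin t) → + 0 ℤ.< f i) ⊎ ((i : Fin t) → f i ℤ.< + 0)
  where open import Data.Sum using (_⊎_)

Monotone : ∀ {t} → (Fin t → ℤ) → (Fin t → ℤ) → Set
Monotone α β = SameSign α × SameSign β
  where open import Data.Product using (_×_)

-- Polynomials in ℤ[x,y,z]: a coefficient array c (i , j , k) of the
-- monomial x^i y^j z^k, with all exponents < N (dense representation,
-- so "monomials with nonzero coefficient" are exactly those with
-- coeff ≢ 0).

record Poly : Set where
  constructor poly
  field
    N     : ℕ
    coeff : Fin N → Fin N → Fin N → ℤ
open Poly public

xzDeg≤ : Poly → ℕ → Set
xzDeg≤ P d = ∀ i j k → coeff P i j k ≢ + 0 → toℕ i ℕ.+ toℕ k ℕ.≤ d
  where open import Relation.Binary.PropositionalEquality using (_≢_)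

module Over (R : CommutativeRing 0ℓ 0ℓ) where
  open CommutativeRing R using (Carrier; _+_; _*_; -_; _-_; 0#; 1#)

  record M2 : Set where
    constructor mat
    field
      a b c d : Carrier
  open M2 public

  _⊗_ : M2 → M2 → M2
  mat a₁ b₁ c₁ d₁ ⊗ mat a₂ b₂ c₂ d₂ =
    mat (a₁ * a₂ + b₁ * c₂) (a₁ * b₂ + b₁ * d₂)
        (c₁ * a₂ + d₁ * c₂) (c₁ * b₂ + d₁ * d₂)

  I₂ : M2
  I₂ = mat 1# 0# 0# 1#

  det : M2 → Carrier
  det (mat a b c d) = a * d - b * c

  tr : M2 → Carrier
  tr (mat a b c d) = a + d

  -- inverse of a determinant-one matrix (adjugate)
  inv : M2 → M2
  inv (mat a b c d) = mat d (- b) (- c) a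

  powℕ : M2 → ℕ → M2
  powℕ A zero    = I₂
  powℕ A (suc n) = A ⊗ powℕ A n

  pow : M2 → ℤ → M2
  pow A (+ n)      = powℕ A n
  pow A -[1+ n ]   = powℕ (inv A) (suc n)

  evalWord : ∀ {t} → (Fin t → ℤ) → (Fin t → ℤ) → M2 → M2 → M2
  evalWord {zero}  α β A B = I₂
  evalWord {suc t} α β A B =
    (pow A (α zero) ⊗ pow B (β zero)) ⊗ evalWord (λ i → α (suc i)) (λ i → β (suc i)) A B

  ιℕ : ℕ → Carrier
  ιℕ zero    = 0#
  ιℕ (suc n) = 1# + ιℕ n

  ι : ℤ → Carrier
  ι (+ n)       = ιℕ n
  ι -[1+ n ]    = - ιℕ (suc n)

  _^_ : Carrier → ℕ → Carrier
  x ^ zero  = 1#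
  x ^ suc n = x * (x ^ n)

  sumR : ∀ {n} → (Fin n → Carrier) → Carrier
  sumR {zero}  f = 0#
  sumR {suc n} f = f zero + sumR (λ i → f (suc i))

  evalPoly : Poly → Carrier → Carrier → Carrier → Carrier
  evalPoly P x y z =
    sumR λ i → sumR λ j → sumR λ k →
      ι (coeff P i j k) * ((x ^ toℕ i) * ((y ^ toℕ j) * (z ^ toℕ k)))

IsTracePoly : ∀ {t} → (Fin t → ℤ) → (Fin t → ℤ) → Poly → Set₁
IsTracePoly α β P =
  (R : CommutativeRing 0ℓ 0ℓ) → let open CommutativeRing R using (_≈_; 1#) ; open Over R in
  (A B : M2) → det A ≈ 1# → det B ≈ 1# →
  tr (evalWord α β A B) ≈ evalPoly P (tr A) (tr B) (tr (A ⊗ B))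

-- Evaluate w at A = [[sⁿ, 1], [-1, 0]] and B = [[s, 1], [sᵐ⁺¹ - 1, sᵐ]] in SL₂(ℤ[[s]]).
-- The traces x = sⁿ, y = s + sᵐ and z = tr AB = sⁿ⁺¹ + sᵐ⁺¹ - 2 are monic of degrees n, m
-- and n + 1, while A^{±1} and B^{±1} have entries of degree at most n and m + 1, so
-- P(x, y, z) = tr w(A, B) has degree at most Σ|αᵢ| n + Σ|βᵢ| (m + 1). A monomial c xⁱ yʲ zᵏ
-- of P (all exponents below N) becomes c s^(i n + j m + k (n + 1)) plus lower terms; once
-- m ≥ N and n ≥ N m these weights are pairwise distinct, so the heaviest monomial of P cannot
-- cancel and (i + k) n ≤ Σ|αᵢ| n + Σ|βᵢ| (m + 1). With n > Σ|βᵢ| (m + 1) this gives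
-- i + k ≤ Σ|αᵢ|, which is |a| because the αᵢ have a common sign; no other hypothesis is used.

module Submission where

open import Defs
open import Data.Nat using (ℕ; _≤_)
open import Data.Integer using (ℤ; ∣_∣)
open import Data.Fin using (Fin)
open import Data.Fin using (toℕ)
import Data.Fin as Fin
import Data.Fin.Properties as Fin

open import Level using (0ℓ)
open import Function using (_∘_)
open import Data.Nat as ℕ using (zero; suc; _<_; z≤n; s≤s)
import Data.Nat.Properties as ℕ
import Data.Nat.DivMod as ℕ
open import Data.Nat.DivMod using (_%_)
open import Data.Integer as ℤ using (0ℤ; 1ℤ; _+_; _*_; -_)
import Data.Integer.Properties as ℤ
open import Data.Integer.Tactic.RingSolver using (solve-∀)
open import Data.Nat.Tactic.RingSolver renaming (solve-∀ to ℕ-solve-∀)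
open import Data.Product using (_,_; _×_; proj₁; proj₂)
open import Data.Sum using (inj₁; inj₂)
open import Relation.Binary.PropositionalEquality
open import Relation.Nullary using (yes; no; contradiction)
open import Algebra.Bundles using (CommutativeRing)
open import Algebra.Structures using (IsCommutativeRing)
import Algebra.Construct.Pointwise as Pointwise

sum-cong : ∀ {n} {f g : Fin n → ℤ} → (∀ i → f i ≡ g i) → sumℤ f ≡ sumℤ g
sum-cong {zero}  f≡g = refl
sum-cong {suc n} f≡g = cong₂ _+_ (f≡g Fin.zero) (sum-cong (f≡g ∘ Fin.suc))

sum-zero : ∀ {n} (f : Fin n → ℤ) → (∀ i → f i ≡ 0ℤ) → sumℤ f ≡ 0ℤ
sum-zero {zero}  f f≡0 = refl
sum-zero {suc n} f f≡0 = cong₂ _+_ (f≡0 Fin.zero) (sum-zero (f ∘ Fin.suc) (f≡0 ∘ Fin.suc))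

sum-single : ∀ {n} (f : Fin n → ℤ) i → (∀ j → j ≢ i → f j ≡ 0ℤ) → sumℤ f ≡ f i
sum-single {suc n} f Fin.zero f≡0 =
  trans (cong (f Fin.zero +_) (sum-zero (f ∘ Fin.suc) (λ j → f≡0 (Fin.suc j) λ ())))
        (ℤ.+-identityʳ (f Fin.zero))
sum-single {suc n} f (Fin.suc i) f≡0 =
  trans (cong (_+ sumℤ (f ∘ Fin.suc)) (f≡0 Fin.zero λ ()))
        (trans (ℤ.+-identityˡ _)
               (sum-single (f ∘ Fin.suc) i λ j j≢i → f≡0 (Fin.suc j) (j≢i ∘ Fin.suc-injective)))

sum³-single : ∀ {n} (g : Fin n → Fin n → Fin n → ℤ) i j k →
              (∀ i′ j′ k′ → (i′ , j′ , k′) ≢ (i , j , k) → g i′ j′ k′ ≡ 0ℤ) →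
              sumℤ (λ i′ → sumℤ (λ j′ → sumℤ (λ k′ → g i′ j′ k′))) ≡ g i j k
sum³-single g i j k g≡0 = begin
  sumℤ (λ i′ → sumℤ (λ j′ → sumℤ (λ k′ → g i′ j′ k′)))
    ≡⟨ sum-single _ i (λ i′ i′≢i → sum-zero _ λ j′ → sum-zero _ λ k′ →
                         g≡0 i′ j′ k′ (i′≢i ∘ cong proj₁)) ⟩
  sumℤ (λ j′ → sumℤ (λ k′ → g i j′ k′))
    ≡⟨ sum-single _ j (λ j′ j′≢j → sum-zero _ λ k′ → g≡0 i j′ k′ (j′≢j ∘ cong (proj₁ ∘ proj₂))) ⟩
  sumℤ (λ k′ → g i j k′)
    ≡⟨ sum-single _ k (λ k′ k′≢k → g≡0 i j k′ (k′≢k ∘ cong (proj₂ ∘ proj₂))) ⟩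
  g i j k
    ∎
  where open ≡-Reasoning

absSum : ∀ {t} → (Fin t → ℤ) → ℕ
absSum {zero}  f = 0
absSum {suc t} f = ∣ f Fin.zero ∣ ℕ.+ absSum (f ∘ Fin.suc)

sumℤ≡+absSum : ∀ {t} (α : Fin t → ℤ) → (∀ i → 0ℤ ℤ.< α i) → sumℤ α ≡ ℤ.+ absSum α
sumℤ≡+absSum {zero}  α α>0 = refl
sumℤ≡+absSum {suc t} α α>0 = begin
  α₀ + sumℤ (α ∘ Fin.suc)              ≡⟨ cong₂ _+_ (sym (ℤ.0≤i⇒+∣i∣≡i (ℤ.<⇒≤ (α>0 Fin.zero))))
                                                     (sumℤ≡+absSum (α ∘ Fin.suc) (α>0 ∘ Fin.suc)) ⟩
  ℤ.+ ∣ α₀ ∣ + ℤ.+ absSum (α ∘ Fin.suc) ≡⟨ ℤ.pos-+ ∣ α₀ ∣ _ ⟨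
  ℤ.+ absSum α                          ∎
  where
  open ≡-Reasoning
  α₀ : ℤ
  α₀ = α Fin.zero

sumℤ≡-absSum : ∀ {t} (α : Fin t → ℤ) → (∀ i → α i ℤ.< 0ℤ) → sumℤ α ≡ - ℤ.+ absSum α
sumℤ≡-absSum {zero}  α α<0 = refl
sumℤ≡-absSum {suc t} α α<0 = begin
  α₀ + sumℤ (α ∘ Fin.suc)                  ≡⟨ cong₂ _+_ (i≡-∣i∣ (α<0 Fin.zero))
                                                         (sumℤ≡-absSum (α ∘ Fin.suc) (α<0 ∘ Fin.suc)) ⟩
  - ℤ.+ ∣ α₀ ∣ + - ℤ.+ absSum (α ∘ Fin.suc) ≡⟨ ℤ.neg-distrib-+ (ℤ.+ ∣ α₀ ∣) _ ⟨
  - (ℤ.+ ∣ α₀ ∣ + ℤ.+ absSum (α ∘ Fin.suc)) ≡⟨ cong -_ (ℤ.pos-+ ∣ α₀ ∣ _) ⟨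
  - ℤ.+ absSum α                            ∎
  where
  open ≡-Reasoning
  α₀ : ℤ
  α₀ = α Fin.zero
  i≡-∣i∣ : ∀ {i} → i ℤ.< 0ℤ → i ≡ - ℤ.+ ∣ i ∣
  i≡-∣i∣ {ℤ.-[1+ _ ]} _ = refl
  i≡-∣i∣ {ℤ.+ _}      (ℤ.+<+ ())

∣sumℤ∣≡absSum : ∀ {t} (α : Fin t → ℤ) → SameSign α → ∣ sumℤ α ∣ ≡ absSum α
∣sumℤ∣≡absSum α (inj₁ α>0) = cong ∣_∣ (sumℤ≡+absSum α α>0)
∣sumℤ∣≡absSum α (inj₂ α<0) = trans (cong ∣_∣ (sumℤ≡-absSum α α<0)) (ℤ.∣-i∣≡∣i∣ (ℤ.+ absSum α))

quotRem-injective : ∀ {d q q′ r r′} → r < d → r′ < d →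
                    r ℕ.+ q ℕ.* d ≡ r′ ℕ.+ q′ ℕ.* d → r ≡ r′ × q ≡ q′
quotRem-injective {suc d} {q} {q′} {r} {r′} r<d r′<d eq = r≡r′ , q≡q′
  where
  open ≡-Reasoning
  r≡r′ : r ≡ r′
  r≡r′ = begin
    r                             ≡⟨ ℕ.m<n⇒m%n≡m r<d ⟨
    r % suc d                     ≡⟨ ℕ.[m+kn]%n≡m%n r q (suc d) ⟨
    (r ℕ.+ q ℕ.* suc d) % suc d   ≡⟨ cong (_% suc d) eq ⟩
    (r′ ℕ.+ q′ ℕ.* suc d) % suc d ≡⟨ ℕ.[m+kn]%n≡m%n r′ q′ (suc d) ⟩
    r′ % suc d                    ≡⟨ ℕ.m<n⇒m%n≡m r′<d ⟩
    r′                            ∎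
  q≡q′ : q ≡ q′
  q≡q′ = ℕ.*-cancelʳ-≡ q q′ (suc d) (ℕ.+-cancelˡ-≡ r _ _ (trans eq (cong (ℕ._+ q′ ℕ.* suc d) (sym r≡r′))))

quotient-≤ : ∀ {q a r n} → q ℕ.* n ≤ a ℕ.* n ℕ.+ r → r < n → q ≤ a
quotient-≤ {q} {a} {r} {n} qn≤an+r r<n with q ℕ.≤? a
... | yes q≤a = q≤a
... | no  q≰a = contradiction (ℕ.≤-<-trans (ℕ.≤-trans (ℕ.*-monoˡ-≤ n (ℕ.≰⇒> q≰a)) qn≤an+r)
                                            (ℕ.+-monoʳ-< (a ℕ.* n) r<n))
                             (ℕ.<-irrefl (ℕ.+-comm n (a ℕ.* n)))

Series : Set
Series = ℕ → ℤ

tail : Series → Series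
tail f = f ∘ suc

infixl 6 _+ₛ_
infixl 7 _*ₛ_ _·ₛ_

_+ₛ_ : Series → Series → Series
(f +ₛ g) k = f k + g k

-ₛ_ : Series → Series
(-ₛ f) k = - f k

0ₛ : Series
0ₛ _ = 0ℤ

_·ₛ_ : ℤ → Series → Series
(c ·ₛ f) k = c * f k

s^_ : ℕ → Series
(s^ zero)  zero    = 1ℤ
(s^ zero)  (suc k) = 0ℤ
(s^ suc e) zero    = 0ℤ
(s^ suc e) (suc k) = (s^ e) k

1ₛ : Series
1ₛ = s^ 0

-- f g = f₀ g + s (tail f) g
_*ₛ_ : Series → Series → Series
(f *ₛ g) zero    = f 0 * g 0
(f *ₛ g) (suc k) = f 0 * g (suc k) + (tail f *ₛ g) k

*ₛ-congˡ : ∀ {f f′} g → f ≗ f′ → f *ₛ g ≗ f′ *ₛ g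
*ₛ-congˡ g f≗f′ zero    = cong (_* g 0) (f≗f′ 0)
*ₛ-congˡ g f≗f′ (suc k) =
  cong₂ _+_ (cong (_* g (suc k)) (f≗f′ 0)) (*ₛ-congˡ g (f≗f′ ∘ suc) k)

*ₛ-congʳ : ∀ f {g g′} → g ≗ g′ → f *ₛ g ≗ f *ₛ g′
*ₛ-congʳ f g≗g′ zero    = cong (f 0 *_) (g≗g′ 0)
*ₛ-congʳ f g≗g′ (suc k) =
  cong₂ _+_ (cong (f 0 *_) (g≗g′ (suc k))) (*ₛ-congʳ (tail f) g≗g′ k)

*ₛ-zeroˡ : ∀ {f} g → f ≗ 0ₛ → f *ₛ g ≗ 0ₛ
*ₛ-zeroˡ g f≗0 zero    rewrite f≗0 0 = refl
*ₛ-zeroˡ g f≗0 (suc k) rewrite f≗0 0 | *ₛ-zeroˡ g (f≗0 ∘ suc) k = refl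

*ₛ-identityˡ : ∀ g → 1ₛ *ₛ g ≗ g
*ₛ-identityˡ g zero    = ℤ.*-identityˡ (g 0)
*ₛ-identityˡ g (suc k) rewrite *ₛ-zeroˡ {tail 1ₛ} g (λ _ → refl) k =
  trans (ℤ.+-identityʳ _) (ℤ.*-identityˡ (g (suc k)))

*ₛ-expandʳ : ∀ f g k → (f *ₛ g) (suc k) ≡ (f *ₛ tail g) k + f (suc k) * g 0
*ₛ-expandʳ f g zero    = refl
*ₛ-expandʳ f g (suc k) rewrite *ₛ-expandʳ (tail f) g k =
  sym (ℤ.+-assoc (f 0 * g (suc (suc k))) ((tail f *ₛ tail g) k) _)

*ₛ-comm : ∀ f g → f *ₛ g ≗ g *ₛ f
*ₛ-comm f g zero    = ℤ.*-comm (f 0) (g 0)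
*ₛ-comm f g (suc k) rewrite *ₛ-expandʳ g f k | *ₛ-comm (tail f) g k =
  trans (ℤ.+-comm (f 0 * g (suc k)) _) (cong ((g *ₛ tail f) k +_) (ℤ.*-comm (f 0) (g (suc k))))

*ₛ-distribˡ : ∀ f g h → f *ₛ (g +ₛ h) ≗ f *ₛ g +ₛ f *ₛ h
*ₛ-distribˡ f g h zero    = ℤ.*-distribˡ-+ (f 0) (g 0) (h 0)
*ₛ-distribˡ f g h (suc k) rewrite *ₛ-distribˡ (tail f) g h k =
  interchange (f 0) (g (suc k)) (h (suc k)) ((tail f *ₛ g) k) ((tail f *ₛ h) k)
  where
  interchange : ∀ a b c d e → a * (b + c) + (d + e) ≡ (a * b + d) + (a * c + e)
  interchange = solve-∀

*ₛ-distribʳ : ∀ f g h → (g +ₛ h) *ₛ f ≗ g *ₛ f +ₛ h *ₛ f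
*ₛ-distribʳ f g h k = begin
  ((g +ₛ h) *ₛ f) k    ≡⟨ *ₛ-comm (g +ₛ h) f k ⟩
  (f *ₛ (g +ₛ h)) k    ≡⟨ *ₛ-distribˡ f g h k ⟩
  (f *ₛ g +ₛ f *ₛ h) k ≡⟨ cong₂ _+_ (*ₛ-comm f g k) (*ₛ-comm f h k) ⟩
  (g *ₛ f +ₛ h *ₛ f) k ∎
  where open ≡-Reasoning

*ₛ-scaleˡ : ∀ c f g → (c ·ₛ f) *ₛ g ≗ c ·ₛ (f *ₛ g)
*ₛ-scaleˡ c f g zero    = ℤ.*-assoc c (f 0) (g 0)
*ₛ-scaleˡ c f g (suc k) rewrite *ₛ-scaleˡ c (tail f) g k | ℤ.*-assoc c (f 0) (g (suc k)) =
  sym (ℤ.*-distribˡ-+ c _ _)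

*ₛ-assoc : ∀ f g h → (f *ₛ g) *ₛ h ≗ f *ₛ (g *ₛ h)
*ₛ-assoc f g h zero    = ℤ.*-assoc (f 0) (g 0) (h 0)
*ₛ-assoc f g h (suc k) = begin
  (f 0 * g 0) * h (suc k) + (tail (f *ₛ g) *ₛ h) k
    ≡⟨ cong ((f 0 * g 0) * h (suc k) +_) (*ₛ-distribʳ h (f 0 ·ₛ tail g) (tail f *ₛ g) k) ⟩
  (f 0 * g 0) * h (suc k) + (((f 0 ·ₛ tail g) *ₛ h) k + ((tail f *ₛ g) *ₛ h) k)
    ≡⟨ cong₂ (λ a b → (f 0 * g 0) * h (suc k) + (a + b))
             (*ₛ-scaleˡ (f 0) (tail g) h k) (*ₛ-assoc (tail f) g h k) ⟩
  (f 0 * g 0) * h (suc k) + (f 0 * (tail g *ₛ h) k + (tail f *ₛ (g *ₛ h)) k)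
    ≡⟨ regroup (f 0) (g 0) (h (suc k)) ((tail g *ₛ h) k) ((tail f *ₛ (g *ₛ h)) k) ⟩
  f 0 * (g 0 * h (suc k) + (tail g *ₛ h) k) + (tail f *ₛ (g *ₛ h)) k
    ∎
  where
  open ≡-Reasoning
  regroup : ∀ a b c d e → (a * b) * c + (a * d + e) ≡ a * (b * c + d) + e
  regroup = solve-∀

*ₛ-zeroʳ : ∀ f → f *ₛ 0ₛ ≗ 0ₛ
*ₛ-zeroʳ f k = trans (*ₛ-comm f 0ₛ k) (*ₛ-zeroˡ f (λ _ → refl) k)

s^-+ : ∀ a b → s^ a *ₛ s^ b ≗ s^ (a ℕ.+ b)
s^-+ zero    b k       = *ₛ-identityˡ (s^ b) k
s^-+ (suc a) b zero    = ℤ.*-zeroˡ ((s^ b) 0)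
s^-+ (suc a) b (suc k) = trans (ℤ.+-identityˡ _) (s^-+ a b k)

ℤ[[s]]-isCommutativeRing : IsCommutativeRing _≗_ _+ₛ_ _*ₛ_ -ₛ_ 0ₛ 1ₛ
ℤ[[s]]-isCommutativeRing = record
  { isRing = record
    { +-isAbelianGroup = Pointwise.isAbelianGroup ℕ ℤ.+-0-isAbelianGroup
    ; *-cong = λ {f} {f′} {g} f≗f′ g≗g′ k → trans (*ₛ-congˡ g f≗f′ k) (*ₛ-congʳ f′ g≗g′ k)
    ; *-assoc = *ₛ-assoc
    ; *-identity = *ₛ-identityˡ , λ g k → trans (*ₛ-comm g 1ₛ k) (*ₛ-identityˡ g k)
    ; distrib = *ₛ-distribˡ , *ₛ-distribʳ
    }
  ; *-comm = *ₛ-comm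
  }

ℤ[[s]] : CommutativeRing 0ℓ 0ℓ
ℤ[[s]] = record { isCommutativeRing = ℤ[[s]]-isCommutativeRing }

Deg≤ : ℕ → Series → Set
Deg≤ d f = ∀ k → d < k → f k ≡ 0ℤ

Deg≤-resp : ∀ {d f g} → f ≗ g → Deg≤ d f → Deg≤ d g
Deg≤-resp f≗g f≤d k d<k = trans (sym (f≗g k)) (f≤d k d<k)

Deg≤-mono : ∀ {d d′ f} → d ≤ d′ → Deg≤ d f → Deg≤ d′ f
Deg≤-mono d≤d′ f≤d k d′<k = f≤d k (ℕ.≤-<-trans d≤d′ d′<k)

0ₛ-Deg≤ : ∀ {d} → Deg≤ d 0ₛ
0ₛ-Deg≤ _ _ = refl

+ₛ-Deg≤ : ∀ {d f g} → Deg≤ d f → Deg≤ d g → Deg≤ d (f +ₛ g)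
+ₛ-Deg≤ f≤d g≤d k d<k = cong₂ _+_ (f≤d k d<k) (g≤d k d<k)

-ₛ-Deg≤ : ∀ {d f} → Deg≤ d f → Deg≤ d (-ₛ f)
-ₛ-Deg≤ f≤d k d<k = cong -_ (f≤d k d<k)

s^-Deg≤ : ∀ e → Deg≤ e (s^ e)
s^-Deg≤ zero    (suc k) _         = refl
s^-Deg≤ (suc e) (suc k) (s≤s e<k) = s^-Deg≤ e k e<k

s^-leading : ∀ e → (s^ e) e ≡ 1ℤ
s^-leading zero    = refl
s^-leading (suc e) = s^-leading e

1ₛ-Deg≤ : ∀ {d} → Deg≤ d 1ₛ
1ₛ-Deg≤ = Deg≤-mono z≤n (s^-Deg≤ 0)

*ₛ-Deg≤ : ∀ {a b f g} → Deg≤ a f → Deg≤ b g → Deg≤ (a ℕ.+ b) (f *ₛ g)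
*ₛ-Deg≤ {zero} {b} {f} {g} f≤a g≤b (suc k) a+b<k =
  cong₂ _+_ (trans (cong (f 0 *_) (g≤b (suc k) a+b<k)) (ℤ.*-zeroʳ (f 0)))
            (*ₛ-zeroˡ g (λ k → f≤a (suc k) (s≤s z≤n)) k)
*ₛ-Deg≤ {suc a} {b} {f} {g} f≤a g≤b (suc k) (s≤s a+b<k) =
  cong₂ _+_ (trans (cong (f 0 *_) (g≤b (suc k) (s≤s (ℕ.≤-trans (ℕ.m≤n+m b a) (ℕ.<⇒≤ a+b<k)))))
                   (ℤ.*-zeroʳ (f 0)))
            (*ₛ-Deg≤ (λ k a<k → f≤a (suc k) (s≤s a<k)) g≤b k a+b<k)

*ₛ-leading : ∀ {a b f g} → Deg≤ a f → Deg≤ b g → (f *ₛ g) (a ℕ.+ b) ≡ f a * g b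
*ₛ-leading {zero}  {zero}  f≤a g≤b = refl
*ₛ-leading {zero}  {suc b} {f} {g} f≤a g≤b =
  trans (cong (f 0 * g (suc b) +_) (*ₛ-zeroˡ g (λ k → f≤a (suc k) (s≤s z≤n)) b)) (ℤ.+-identityʳ _)
*ₛ-leading {suc a} {b} {f} {g} f≤a g≤b =
  trans (cong₂ _+_ (trans (cong (f 0 *_) (g≤b (suc (a ℕ.+ b)) (s≤s (ℕ.m≤n+m b a)))) (ℤ.*-zeroʳ (f 0)))
                   (*ₛ-leading (λ k a<k → f≤a (suc k) (s≤s a<k)) g≤b))
        (ℤ.+-identityˡ _)

record Monic (d : ℕ) (f : Series) : Set where
  field
    deg≤    : Deg≤ d f
    leading : f d ≡ 1ℤ
open Monic

Monic-resp : ∀ {d f g} → f ≗ g → Monic d f → Monic d g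
Monic-resp f≗g f-monic = record
  { deg≤ = Deg≤-resp f≗g (deg≤ f-monic) ; leading = trans (sym (f≗g _)) (leading f-monic) }

s^-Monic : ∀ e → Monic e (s^ e)
s^-Monic e = record { deg≤ = s^-Deg≤ e ; leading = s^-leading e }

*ₛ-Monic : ∀ {a b f g} → Monic a f → Monic b g → Monic (a ℕ.+ b) (f *ₛ g)
*ₛ-Monic f-monic g-monic = record
  { deg≤    = *ₛ-Deg≤ (deg≤ f-monic) (deg≤ g-monic)
  ; leading = trans (*ₛ-leading (deg≤ f-monic) (deg≤ g-monic))
                    (cong₂ _*_ (leading f-monic) (leading g-monic))
  }

+ₛ-Monic-lowerʳ : ∀ {d e f g} → Monic d f → Deg≤ e g → e < d → Monic d (f +ₛ g)
+ₛ-Monic-lowerʳ {d} f-monic g≤e e<d = record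
  { deg≤    = +ₛ-Deg≤ (deg≤ f-monic) (Deg≤-mono (ℕ.<⇒≤ e<d) g≤e)
  ; leading = trans (cong₂ _+_ (leading f-monic) (g≤e d e<d)) (ℤ.+-identityʳ 1ℤ)
  }

open Over ℤ[[s]]

ι-Deg≤ : ∀ c → Deg≤ 0 (ι c)
ι-Deg≤ (ℤ.+ n)    = ιℕ-Deg≤ n
  where
  ιℕ-Deg≤ : ∀ n → Deg≤ 0 (ιℕ n)
  ιℕ-Deg≤ zero    = 0ₛ-Deg≤
  ιℕ-Deg≤ (suc n) = +ₛ-Deg≤ (s^-Deg≤ 0) (ιℕ-Deg≤ n)
ι-Deg≤ ℤ.-[1+ n ] = -ₛ-Deg≤ (ι-Deg≤ (ℤ.+ suc n))

ι-constant : ∀ c → ι c 0 ≡ c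
ι-constant (ℤ.+ n)    = ιℕ-constant n
  where
  ιℕ-constant : ∀ n → ιℕ n 0 ≡ ℤ.+ n
  ιℕ-constant zero    = refl
  ιℕ-constant (suc n) = cong (1ℤ +_) (ιℕ-constant n)
ι-constant ℤ.-[1+ n ] = cong -_ (ι-constant (ℤ.+ suc n))

^-Monic : ∀ {d x} i → Monic d x → Monic (i ℕ.* d) (x ^ i)
^-Monic zero    x-monic = s^-Monic 0
^-Monic (suc i) x-monic = *ₛ-Monic x-monic (^-Monic i x-monic)

sumR-coefficient : ∀ {n} (f : Fin n → Series) k → sumR f k ≡ sumℤ (λ i → f i k)
sumR-coefficient {zero}  f k = refl
sumR-coefficient {suc n} f k = cong (f Fin.zero k +_) (sumR-coefficient (f ∘ Fin.suc) k)

EntriesDeg≤ : ℕ → M2 → Set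
EntriesDeg≤ e (mat a b c d) = Deg≤ e a × Deg≤ e b × Deg≤ e c × Deg≤ e d

⊗-EntriesDeg≤ : ∀ {e e′ X Y} → EntriesDeg≤ e X → EntriesDeg≤ e′ Y → EntriesDeg≤ (e ℕ.+ e′) (X ⊗ Y)
⊗-EntriesDeg≤ {X = mat _ _ _ _} {mat _ _ _ _} (a₁ , b₁ , c₁ , d₁) (a₂ , b₂ , c₂ , d₂) =
  dot a₁ a₂ b₁ c₂ , dot a₁ b₂ b₁ d₂ , dot c₁ a₂ d₁ c₂ , dot c₁ b₂ d₁ d₂
  where
  dot : ∀ {e e′ p q r t} → Deg≤ e p → Deg≤ e′ q → Deg≤ e r → Deg≤ e′ t →
        Deg≤ (e ℕ.+ e′) (p *ₛ q +ₛ r *ₛ t)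
  dot p q r t = +ₛ-Deg≤ (*ₛ-Deg≤ p q) (*ₛ-Deg≤ r t)

I₂-EntriesDeg≤ : EntriesDeg≤ 0 I₂
I₂-EntriesDeg≤ = s^-Deg≤ 0 , 0ₛ-Deg≤ , 0ₛ-Deg≤ , s^-Deg≤ 0

powℕ-EntriesDeg≤ : ∀ {e X} n → EntriesDeg≤ e X → EntriesDeg≤ (n ℕ.* e) (powℕ X n)
powℕ-EntriesDeg≤ zero    X≤e = I₂-EntriesDeg≤
powℕ-EntriesDeg≤ (suc n) X≤e = ⊗-EntriesDeg≤ X≤e (powℕ-EntriesDeg≤ n X≤e)

pow-EntriesDeg≤ : ∀ {e X} c → EntriesDeg≤ e X → EntriesDeg≤ e (inv X) →
                  EntriesDeg≤ (∣ c ∣ ℕ.* e) (pow X c)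
pow-EntriesDeg≤ (ℤ.+ n)    X≤e X⁻¹≤e = powℕ-EntriesDeg≤ n X≤e
pow-EntriesDeg≤ ℤ.-[1+ n ] X≤e X⁻¹≤e = powℕ-EntriesDeg≤ (suc n) X⁻¹≤e

tr-Deg≤ : ∀ {e} X → EntriesDeg≤ e X → Deg≤ e (tr X)
tr-Deg≤ (mat _ _ _ _) (a , _ , _ , d) = +ₛ-Deg≤ a d

evalWord-EntriesDeg≤ : ∀ {t eA eB A B} (α β : Fin t → ℤ) →
  EntriesDeg≤ eA A → EntriesDeg≤ eA (inv A) → EntriesDeg≤ eB B → EntriesDeg≤ eB (inv B) →
  EntriesDeg≤ (absSum α ℕ.* eA ℕ.+ absSum β ℕ.* eB) (evalWord α β A B)
evalWord-EntriesDeg≤ {zero}  α β _ _ _ _ = I₂-EntriesDeg≤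
evalWord-EntriesDeg≤ {suc t} {eA} {eB} {A} {B} α β A≤ A⁻¹≤ B≤ B⁻¹≤ =
  subst (λ e → EntriesDeg≤ e (evalWord α β A B))
        (regroup ∣ α Fin.zero ∣ ∣ β Fin.zero ∣ (absSum (α ∘ Fin.suc)) (absSum (β ∘ Fin.suc)) eA eB)
        (⊗-EntriesDeg≤ (⊗-EntriesDeg≤ (pow-EntriesDeg≤ (α Fin.zero) A≤ A⁻¹≤)
                                      (pow-EntriesDeg≤ (β Fin.zero) B≤ B⁻¹≤))
                       (evalWord-EntriesDeg≤ (α ∘ Fin.suc) (β ∘ Fin.suc) A≤ A⁻¹≤ B≤ B⁻¹≤))
  where
  regroup : ∀ a b a′ b′ eA eB →
            a ℕ.* eA ℕ.+ b ℕ.* eB ℕ.+ (a′ ℕ.* eA ℕ.+ b′ ℕ.* eB) ≡ (a ℕ.+ a′) ℕ.* eA ℕ.+ (b ℕ.+ b′) ℕ.* eB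
  regroup = ℕ-solve-∀

weight : ∀ {N} → ℕ → ℕ → ℕ → Fin N → Fin N → Fin N → ℕ
weight dx dy dz i j k = toℕ i ℕ.* dx ℕ.+ (toℕ j ℕ.* dy ℕ.+ toℕ k ℕ.* dz)

WeightInjective : ℕ → ℕ → ℕ → ℕ → Set
WeightInjective N dx dy dz = ∀ {i j k i′ j′ k′ : Fin N} →
  weight dx dy dz i j k ≡ weight dx dy dz i′ j′ k′ → (i , j , k) ≡ (i′ , j′ , k′)

module _ (P : Poly) {x y z : Series} {dx dy dz : ℕ}
         (x-monic : Monic dx x) (y-monic : Monic dy y) (z-monic : Monic dz z) where

  private
    term : Fin (N P) → Fin (N P) → Fin (N P) → Series
    term i j k = ι (coeff P i j k) *ₛ ((x ^ toℕ i) *ₛ ((y ^ toℕ j) *ₛ (z ^ toℕ k)))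

    wt : Fin (N P) → Fin (N P) → Fin (N P) → ℕ
    wt = weight dx dy dz

    monomial-Monic : ∀ i j k → Monic (wt i j k) ((x ^ toℕ i) *ₛ ((y ^ toℕ j) *ₛ (z ^ toℕ k)))
    monomial-Monic i j k =
      *ₛ-Monic (^-Monic (toℕ i) x-monic) (*ₛ-Monic (^-Monic (toℕ j) y-monic) (^-Monic (toℕ k) z-monic))

    term-Deg≤ : ∀ i j k → Deg≤ (wt i j k) (term i j k)
    term-Deg≤ i j k = *ₛ-Deg≤ (ι-Deg≤ (coeff P i j k)) (deg≤ (monomial-Monic i j k))

    term-leading : ∀ i j k → term i j k (wt i j k) ≡ coeff P i j k
    term-leading i j k = begin
      term i j k (wt i j k)
        ≡⟨ *ₛ-leading (ι-Deg≤ (coeff P i j k)) (deg≤ (monomial-Monic i j k)) ⟩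
      ι (coeff P i j k) 0 * _
        ≡⟨ cong₂ _*_ (ι-constant (coeff P i j k)) (leading (monomial-Monic i j k)) ⟩
      coeff P i j k * 1ℤ
        ≡⟨ ℤ.*-identityʳ _ ⟩
      coeff P i j k
        ∎
      where open ≡-Reasoning

    term-vanishes : ∀ i j k → coeff P i j k ≡ 0ℤ → term i j k ≗ 0ₛ
    term-vanishes i j k c≡0 rewrite c≡0 = *ₛ-zeroˡ _ (λ _ → refl)

    evalPoly-coefficient : ∀ e →
      evalPoly P x y z e ≡ sumℤ (λ i → sumℤ (λ j → sumℤ (λ k → term i j k e)))
    evalPoly-coefficient e =
      trans (sumR-coefficient (λ i → sumR λ j → sumR λ k → term i j k) e) (sum-cong λ i →
      trans (sumR-coefficient (λ j → sumR λ k → term i j k) e) (sum-cong λ j →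
      sumR-coefficient (λ k → term i j k) e))

  WeightsBounded : ℕ → Set
  WeightsBounded V = ∀ i j k → coeff P i j k ≢ 0ℤ → weight dx dy dz i j k ≤ V

  private
    weightsBounded-pred : WeightInjective (N P) dx dy dz → ∀ {W V} →
                          Deg≤ W (evalPoly P x y z) → W ≤ V →
                          WeightsBounded (suc V) → WeightsBounded V
    weightsBounded-pred inj {W} {V} eval≤W W≤V bounded i j k c≢0 with wt i j k ℕ.≤? V
    ... | yes wt≤V = wt≤V
    ... | no  wt≰V = contradiction c≡0 c≢0
      where
      wt≡1+V : wt i j k ≡ suc V
      wt≡1+V = ℕ.≤-antisym (bounded i j k c≢0) (ℕ.≰⇒> wt≰V)

      others-vanish : ∀ i′ j′ k′ → (i′ , j′ , k′) ≢ (i , j , k) → term i′ j′ k′ (suc V) ≡ 0ℤ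
      others-vanish i′ j′ k′ ≢ijk with coeff P i′ j′ k′ ℤ.≟ 0ℤ
      ... | yes c′≡0 = term-vanishes i′ j′ k′ c′≡0 (suc V)
      ... | no  c′≢0 with wt i′ j′ k′ ℕ.≤? V
      ...   | yes wt′≤V = term-Deg≤ i′ j′ k′ (suc V) (s≤s wt′≤V)
      ...   | no  wt′≰V =
        contradiction (inj (trans (ℕ.≤-antisym (bounded i′ j′ k′ c′≢0) (ℕ.≰⇒> wt′≰V)) (sym wt≡1+V))) ≢ijk

      c≡0 : coeff P i j k ≡ 0ℤ
      c≡0 = begin
        coeff P i j k
          ≡⟨ sym (term-leading i j k) ⟩
        term i j k (wt i j k)
          ≡⟨ cong (term i j k) wt≡1+V ⟩
        term i j k (suc V)
          ≡⟨ sym (sum³-single (λ i′ j′ k′ → term i′ j′ k′ (suc V)) i j k others-vanish) ⟩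
        sumℤ (λ i′ → sumℤ (λ j′ → sumℤ (λ k′ → term i′ j′ k′ (suc V))))
          ≡⟨ sym (evalPoly-coefficient (suc V)) ⟩
        evalPoly P x y z (suc V)
          ≡⟨ eval≤W (suc V) (s≤s W≤V) ⟩
        0ℤ
          ∎
        where open ≡-Reasoning

  evalPoly-Deg≤⇒weightsBounded : WeightInjective (N P) dx dy dz →
    ∀ {W} → Deg≤ W (evalPoly P x y z) → WeightsBounded W
  evalPoly-Deg≤⇒weightsBounded inj {W} eval≤W = descend top weights≤W+top
    where
    top : ℕ
    top = N P ℕ.* dx ℕ.+ (N P ℕ.* dy ℕ.+ N P ℕ.* dz)

    weights≤W+top : WeightsBounded (W ℕ.+ top)
    weights≤W+top i j k _ = ℕ.≤-trans
      (ℕ.+-mono-≤ (ℕ.*-monoˡ-≤ dx (ℕ.<⇒≤ (Fin.toℕ<n i)))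
        (ℕ.+-mono-≤ (ℕ.*-monoˡ-≤ dy (ℕ.<⇒≤ (Fin.toℕ<n j))) (ℕ.*-monoˡ-≤ dz (ℕ.<⇒≤ (Fin.toℕ<n k)))))
      (ℕ.m≤n+m top W)

    descend : ∀ d → WeightsBounded (W ℕ.+ d) → WeightsBounded W
    descend zero    = subst WeightsBounded (ℕ.+-identityʳ W)
    descend (suc d) bounded =
      descend d (weightsBounded-pred inj eval≤W (ℕ.m≤m+n W d) (subst WeightsBounded (ℕ.+-suc W d) bounded))

weight-digits : ∀ {N} n m (i j k : Fin N) →
  weight n m (n ℕ.+ 1) i j k ≡ toℕ k ℕ.+ toℕ j ℕ.* m ℕ.+ (toℕ i ℕ.+ toℕ k) ℕ.* n
weight-digits n m i j k = regroup (toℕ i) (toℕ j) (toℕ k) n m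
  where
  regroup : ∀ a b c n m → a ℕ.* n ℕ.+ (b ℕ.* m ℕ.+ c ℕ.* (n ℕ.+ 1)) ≡ c ℕ.+ b ℕ.* m ℕ.+ (a ℕ.+ c) ℕ.* n
  regroup = ℕ-solve-∀

weight-injective : ∀ {N n m} → N ≤ m → N ℕ.* m ≤ n → WeightInjective N n m (n ℕ.+ 1)
weight-injective {N} {n} {m} N≤m Nm≤n {i} {j} {k} {i′} {j′} {k′} eq =
  cong₂ _,_ (Fin.toℕ-injective i≡i′) (cong₂ _,_ (Fin.toℕ-injective j≡j′) (Fin.toℕ-injective k≡k′))
  where
  k<m : (k : Fin N) → toℕ k < m
  k<m k = ℕ.<-≤-trans (Fin.toℕ<n k) N≤m

  low-digits<n : (j k : Fin N) → toℕ k ℕ.+ toℕ j ℕ.* m < n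
  low-digits<n j k = ℕ.<-≤-trans (ℕ.+-monoˡ-< (toℕ j ℕ.* m) (k<m k))
                                  (ℕ.≤-trans (ℕ.*-monoˡ-≤ m (Fin.toℕ<n j)) Nm≤n)

  high-and-low : toℕ k ℕ.+ toℕ j ℕ.* m ≡ toℕ k′ ℕ.+ toℕ j′ ℕ.* m × toℕ i ℕ.+ toℕ k ≡ toℕ i′ ℕ.+ toℕ k′
  high-and-low = quotRem-injective (low-digits<n j k) (low-digits<n j′ k′)
    (trans (sym (weight-digits n m i j k)) (trans eq (weight-digits n m i′ j′ k′)))

  low-digits : toℕ k ≡ toℕ k′ × toℕ j ≡ toℕ j′
  low-digits = quotRem-injective (k<m k) (k<m k′) (proj₁ high-and-low)

  k≡k′ : toℕ k ≡ toℕ k′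
  k≡k′ = proj₁ low-digits
  j≡j′ : toℕ j ≡ toℕ j′
  j≡j′ = proj₂ low-digits
  i≡i′ : toℕ i ≡ toℕ i′
  i≡i′ = ℕ.+-cancelʳ-≡ _ _ _ (trans (proj₂ high-and-low) (cong (toℕ i′ ℕ.+_) (sym k≡k′)))

matA : ℕ → M2
matA n = mat (s^ n) 1ₛ (-ₛ 1ₛ) 0ₛ

matB : ℕ → M2
matB m = mat (s^ 1) 1ₛ (s^ suc m +ₛ -ₛ 1ₛ) (s^ m)

matA-det : ∀ n → det (matA n) ≗ 1ₛ
matA-det n k = begin
  (s^ n *ₛ 0ₛ) k + - (1ₛ *ₛ -ₛ 1ₛ) k
    ≡⟨ cong₂ (λ p q → p + - q) (*ₛ-zeroʳ (s^ n) k) (*ₛ-identityˡ (-ₛ 1ₛ) k) ⟩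
  0ℤ + - - 1ₛ k
    ≡⟨ ℤ.+-identityˡ _ ⟩
  - - 1ₛ k
    ≡⟨ ℤ.neg-involutive _ ⟩
  1ₛ k
    ∎
  where open ≡-Reasoning

matB-det : ∀ m → det (matB m) ≗ 1ₛ
matB-det m k = begin
  (s^ 1 *ₛ s^ m) k + - (1ₛ *ₛ (s^ suc m +ₛ -ₛ 1ₛ)) k
    ≡⟨ cong₂ (λ p q → p + - q) (s^-+ 1 m k) (*ₛ-identityˡ (s^ suc m +ₛ -ₛ 1ₛ) k) ⟩
  (s^ suc m) k + - ((s^ suc m) k + - 1ₛ k)
    ≡⟨ cancel ((s^ suc m) k) (1ₛ k) ⟩
  1ₛ k
    ∎
  where
  open ≡-Reasoning
  cancel : ∀ y o → y + - (y + - o) ≡ o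
  cancel = solve-∀

matA-EntriesDeg≤ : ∀ n → EntriesDeg≤ n (matA n)
matA-EntriesDeg≤ n = s^-Deg≤ n , 1ₛ-Deg≤ , -ₛ-Deg≤ 1ₛ-Deg≤ , 0ₛ-Deg≤

matA⁻¹-EntriesDeg≤ : ∀ n → EntriesDeg≤ n (inv (matA n))
matA⁻¹-EntriesDeg≤ n = 0ₛ-Deg≤ , -ₛ-Deg≤ 1ₛ-Deg≤ , -ₛ-Deg≤ (-ₛ-Deg≤ 1ₛ-Deg≤) , s^-Deg≤ n

matB-EntriesDeg≤ : ∀ m → EntriesDeg≤ (suc m) (matB m)
matB-EntriesDeg≤ m =
  Deg≤-mono (s≤s z≤n) (s^-Deg≤ 1) , 1ₛ-Deg≤ , +ₛ-Deg≤ (s^-Deg≤ (suc m)) (-ₛ-Deg≤ 1ₛ-Deg≤) ,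
  Deg≤-mono (ℕ.n≤1+n m) (s^-Deg≤ m)

matB⁻¹-EntriesDeg≤ : ∀ m → EntriesDeg≤ (suc m) (inv (matB m))
matB⁻¹-EntriesDeg≤ m with matB-EntriesDeg≤ m
... | a , b , c , d = d , -ₛ-Deg≤ b , -ₛ-Deg≤ c , a

tr-matA-Monic : ∀ n → Monic n (tr (matA n))
tr-matA-Monic n = Monic-resp (λ k → sym (ℤ.+-identityʳ ((s^ n) k))) (s^-Monic n)

tr-matB-Monic : ∀ {m} → 1 < m → Monic m (tr (matB m))
tr-matB-Monic {m} 1<m =
  Monic-resp (λ k → ℤ.+-comm ((s^ m) k) ((s^ 1) k)) (+ₛ-Monic-lowerʳ (s^-Monic m) (s^-Deg≤ 1) 1<m)

tr-matAB-Monic : ∀ {n m} → m < n → Monic (n ℕ.+ 1) (tr (matA n ⊗ matB m))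
tr-matAB-Monic {n} {m} m<n =
  +ₛ-Monic-lowerʳ
    (+ₛ-Monic-lowerʳ (*ₛ-Monic (s^-Monic n) (s^-Monic 1))
                     (*ₛ-Deg≤ (s^-Deg≤ 0) (+ₛ-Deg≤ (s^-Deg≤ (suc m)) (-ₛ-Deg≤ 1ₛ-Deg≤)))
                     1+m<n+1)
    (+ₛ-Deg≤ (Deg≤-mono z≤n (*ₛ-Deg≤ {0} {0} (-ₛ-Deg≤ 1ₛ-Deg≤) 1ₛ-Deg≤)) (*ₛ-Deg≤ 0ₛ-Deg≤ (s^-Deg≤ m)))
    (ℕ.<-trans (ℕ.n<1+n m) 1+m<n+1)
  where
  1+m<n+1 : suc m < n ℕ.+ 1
  1+m<n+1 = ℕ.<-≤-trans (s≤s m<n) (ℕ.≤-reflexive (ℕ.+-comm 1 n))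

xzDeg≤absSum : ∀ {t} (α β : Fin t → ℤ) (P : Poly) → IsTracePoly α β P → xzDeg≤ P (absSum α)
xzDeg≤absSum α β P trace-poly i j k c≢0 =
  quotient-≤ (ℕ.≤-trans xz-part≤weight weight≤W) β-part<n
  where
  m n W : ℕ
  m = suc (suc (N P))
  n = suc (suc (N P) ℕ.* m ℕ.+ absSum β ℕ.* suc m)
  W = absSum α ℕ.* n ℕ.+ absSum β ℕ.* suc m

  β-part<n : absSum β ℕ.* suc m < n
  β-part<n = s≤s (ℕ.m≤n+m _ _)

  xz-part≤weight : (toℕ i ℕ.+ toℕ k) ℕ.* n ≤ weight n m (n ℕ.+ 1) i j k
  xz-part≤weight = ℕ.≤-trans (ℕ.m≤n+m _ _) (ℕ.≤-reflexive (sym (weight-digits n m i j k)))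

  word-trace≤W : Deg≤ W (tr (evalWord α β (matA n) (matB m)))
  word-trace≤W = tr-Deg≤ _ (evalWord-EntriesDeg≤ α β (matA-EntriesDeg≤ n) (matA⁻¹-EntriesDeg≤ n)
                                                     (matB-EntriesDeg≤ m) (matB⁻¹-EntriesDeg≤ m))

  weight≤W : weight n m (n ℕ.+ 1) i j k ≤ W
  weight≤W = evalPoly-Deg≤⇒weightsBounded P
    (tr-matA-Monic n) (tr-matB-Monic (s≤s (s≤s z≤n))) (tr-matAB-Monic m<n)
    (weight-injective (ℕ.m≤n+m (N P) 2) Nm≤n)
    (Deg≤-resp (trace-poly ℤ[[s]] (matA n) (matB m) (matA-det n) (matB-det m)) word-trace≤W)
    i j k c≢0
    where
    m<n : m < n
    m<n = s≤s (ℕ.≤-trans (ℕ.m≤m+n m _) (ℕ.m≤m+n _ _))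
    Nm≤n : N P ℕ.* m ≤ n
    Nm≤n = ℕ.≤-trans (ℕ.m≤n+m _ m) (ℕ.≤-trans (ℕ.m≤m+n _ _) (ℕ.n≤1+n _))

lemma3p6 : (t : ℕ) (α β : Fin t → ℤ) →
    AllNonzero α → AllNonzero β → Monotone α β →
    (P : Poly) → IsTracePoly α β P →
    xzDeg≤ P ∣ sumℤ α ∣
lemma3p6 t α β _ _ (α-sameSign , _) P trace-poly i j k c≢0 =
  subst (toℕ i ℕ.+ toℕ k ≤_) (sym (∣sumℤ∣≡absSum α α-sameSign)) (xzDeg≤absSum α β P trace-poly i j k c≢0)
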